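{- For every integer $k \geq 1$, with $n = 2k+1$, the number $\sigma(k, n)$ of $\sigma$-sequences of length $n$ with first term $a_1 = k$ equals $2$.
   Context: Let $k \geq 1$ and $n = 2k+1$. A $\sigma$-sequence of length $n$ is a sequence of integers $a_1 a_2 \dots a_n$ such that, with all indices taken cyclically modulo $n$: (i) $a_i \geq 0$; (ii) if $a_i = 0$ then $a_{i+(k+1)} = 1$; (iii) if $a_i = 1$ then $a_{i-1} = 0$ or $a_{i+k} = 0$; (iv) if $a_i > 1$ then $a_{i-1} = a_i - 1$; (v) there are at most three indices $i$ with $a_i = 0$. (Equivalently, every cyclic rotation of the sequence satisfies these conditions.) $\sigma(i, n)$ denotes the number of $\sigma$-sequences of length $n$ with $a_1 = i$. -}

module Defs where

open import Data.Nat using (ℕ; zero; suc; _+_; _*_; _∸_; _≤_; NonZero)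
open import Data.Nat.DivMod using (_%_; m%n<n)
open import Data.Fin using (Fin; toℕ; fromℕ<)
open import Data.Vec using (Vec; lookup; toList; head)
open import Data.List using (length; filter)
open import Data.Nat.Properties using (_≟_)
open import Data.Product using (_×_)
open import Data.Sum using (_⊎_)
open import Relation.Binary.PropositionalEquality using (_≡_; _≢_)

-- cyclic index: position (i + m) mod n  (0-based positions; a_1 is position 0)
shift : ∀ {n} .{{_ : NonZero n}} → Fin n → ℕ → Fin n
shift {n} i m = fromℕ< (m%n<n (toℕ i + m) n)

prev : ∀ {n} .{{_ : NonZero n}} → Fin n → Fin n
prev {n} i = shift i (n ∸ 1)

record IsSigma (k : ℕ) (a : Vec ℕ (suc (2 * k))) : Set where
  field
    -- (i) a_i ≥ 0 is automatic for ℕ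
    cond-ii  : ∀ i → lookup a i ≡ 0 → lookup a (shift i (suc k)) ≡ 1
    cond-iii : ∀ i → lookup a i ≡ 1 →
                 (lookup a (prev i) ≡ 0) ⊎ (lookup a (shift i k) ≡ 0)
    cond-iv  : ∀ i m → lookup a i ≡ suc (suc m) → lookup a (prev i) ≡ suc m
    cond-v   : length (filter (_≟ 0) (toList a)) ≤ 3

SigmaCountIsTwo : ℕ → Set
SigmaCountIsTwo k =
  Data.Product.Σ (Vec ℕ (suc (2 * k))) λ s₁ →
  Data.Product.Σ (Vec ℕ (suc (2 * k))) λ s₂ →
    (IsSigma k s₁ × head s₁ ≡ k) ×
    (IsSigma k s₂ × head s₂ ≡ k) ×
    s₁ ≢ s₂ ×
    (∀ a → IsSigma k a → head a ≡ k → (a ≡ s₁) ⊎ (a ≡ s₂))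

module Submission where

-- Positions 0 … 2k of a vector are the indices 1 … n (n = 2k+1, k = c+1) of the
-- paper, read cyclically.  A vector is viewed as an n-periodic function on ℕ, and
-- conditions (ii)–(iv) become three local rules (CyclicSigma), invariant under
-- rotation.  The rules yield "run" (a value v+t forces v+t-1, …, v just before
-- it) and "ascend" (values grow by one unless the cells k, k+1 ahead object).
-- With ω the periodic word 0,1,…,k,1,…,k, a cyclic σ-function g with g(0) = 0
-- and g(k) = k (normal form A) or g(2k) = k (normal form B) equals ω.
-- For a σ-sequence with a₁ = k, "run" gives the value 1 at position k+2, so by
-- (iii) position k+1 or position 1 is zero; rotating it to 0 gives normal form
-- A resp. B, so the sequence is ω rotated by k resp. 2k (Classification).
-- Conversely ω obeys the rules and has one zero per period, so both rotations
-- are σ-sequences, and they differ at position 1.  The file develops zero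
-- counting, cyclic indexing, the rules and their consequences, ω, the passage
-- between vectors and periodic functions, the normal forms, and the theorem.

open import Defs
open import Data.Nat using (ℕ; zero; suc; _+_; _*_; _∸_; _≤_; _<_; _≥_; z≤n; s≤s; s<s⁻¹)
open import Data.Nat.Properties
open import Data.Nat.DivMod using (_%_; m%n<n; m%n%n≡m%n; [m+n]%n≡m%n; %-distribˡ-+; m<n⇒m%n≡m)
open import Data.Nat.Tactic.RingSolver using (solve-∀)
open import Data.Fin using (toℕ; fromℕ<)
import Data.Fin as Fin
open import Data.Fin.Properties using (toℕ-fromℕ<; fromℕ<-cong; fromℕ<-toℕ; toℕ<n)
open import Data.Vec using (Vec; _∷_; lookup; toList; head; tabulate)
open import Data.Vec.Properties using (lookup∘tabulate; tabulate∘lookup; tabulate-cong)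
open import Data.List using (List; length; filter)
open import Data.List.Properties using (filter-accept; filter-reject)
open import Data.Product using (_,_)
open import Data.Sum using (_⊎_; inj₁; inj₂)
open import Data.Empty using (⊥-elim)
open import Relation.Nullary using (yes; no)
open import Relation.Binary.PropositionalEquality

zeros : List ℕ → ℕ
zeros xs = length (filter (_≟ 0) xs)

entries : ∀ m → (ℕ → ℕ) → List ℕ
entries m h = toList (tabulate {n = m} (λ i → h (toℕ i)))

no-zero-entries : ∀ m h → (∀ j → j < m → h j ≢ 0) → zeros (entries m h) ≡ 0
no-zero-entries zero    h nz = refl
no-zero-entries (suc m) h nz =
  trans (cong length (filter-reject (_≟ 0) (nz 0 (s≤s z≤n))))
        (no-zero-entries m (λ j → h (suc j)) (λ j j<m → nz (suc j) (s≤s j<m)))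

at-most-one-zero : ∀ m h → (∀ i j → i < m → j < m → h i ≡ 0 → h j ≡ 0 → i ≡ j) →
                   zeros (entries m h) ≤ 1
at-most-one-zero zero    h unique = z≤n
at-most-one-zero (suc m) h unique with h 0 ≟ 0
... | yes h0≡0 = ≤-reflexive (trans (cong length (filter-accept (_≟ 0) h0≡0))
                   (cong suc (no-zero-entries m (λ j → h (suc j)) later-nonzero)))
  where
    later-nonzero : ∀ j → j < m → h (suc j) ≢ 0
    later-nonzero j j<m e with unique 0 (suc j) (s≤s z≤n) (s≤s j<m) h0≡0 e
    ... | ()
... | no h0≢0 = subst (_≤ 1) (sym (cong length (filter-reject (_≟ 0) h0≢0)))
                  (at-most-one-zero m (λ j → h (suc j))
                     (λ i j i<m j<m hi hj → suc-injective (unique (suc i) (suc j) (s≤s i<m) (s≤s j<m) hi hj)))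

full-turn : ∀ k y → y + suc k + k ≡ y + suc (2 * k)
full-turn = solve-∀

full-turn′ : ∀ k y → y + suc k + suc k ≡ suc y + suc (2 * k)
full-turn′ = solve-∀

half-turns : ∀ k → k + suc k ≡ suc (2 * k)
half-turns = solve-∀

-- Descending c steps from position k+2 = c+3 reaches position n = 2c+3.
tail-length : ∀ c → c + suc (suc (suc c)) ≡ suc (2 * suc c)
tail-length = solve-∀

run-to-2k : ∀ i t → t + (i + suc (suc i + t)) ≡ 2 * (suc i + t)
run-to-2k = solve-∀

double-as-high : ∀ c → 2 * suc c ≡ c + suc (suc c)
double-as-high = solve-∀

module Cycle (c : ℕ) where

  k n : ℕ
  k = suc c
  n = suc (2 * k)

  Periodic : (ℕ → ℕ) → Set
  Periodic f = ∀ x → f (x % n) ≡ f x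

  mod-absorb : ∀ x m → (x % n + m) % n ≡ (x + m) % n
  mod-absorb x m = begin
    (x % n + m) % n          ≡⟨ %-distribˡ-+ (x % n) m n ⟩
    (x % n % n + m % n) % n  ≡⟨ cong (λ r → (r + m % n) % n) (m%n%n≡m%n x n) ⟩
    (x % n + m % n) % n      ≡⟨ %-distribˡ-+ x m n ⟨
    (x + m) % n              ∎
    where open ≡-Reasoning

  module _ {f : ℕ → ℕ} (periodic : Periodic f) where

    periodic-shift : ∀ x m → f (x % n + m) ≡ f (x + m)
    periodic-shift x m =
      trans (sym (periodic (x % n + m))) (trans (cong f (mod-absorb x m)) (periodic (x + m)))

    wrap : ∀ x → f (x + n) ≡ f x
    wrap x = trans (sym (periodic (x + n))) (trans (cong f ([m+n]%n≡m%n x n)) (periodic x))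

    back : ∀ y → f (suc y + 2 * k) ≡ f y
    back y = trans (cong f (sym (+-suc y (2 * k)))) (wrap y)

    rotate-periodic : ∀ d → Periodic (λ x → f (x + d))
    rotate-periodic d x = periodic-shift x d

    agree-everywhere : ∀ {g} → Periodic g → (∀ x → x < n → f x ≡ g x) → ∀ x → f x ≡ g x
    agree-everywhere {g} periodic-g agree x =
      trans (sym (periodic x)) (trans (agree (x % n) (m%n<n x n)) (periodic-g x))

  -- Conditions (ii)–(iv) for a periodic function on ℕ; the cell before x is x + 2k.
  record CyclicSigma (f : ℕ → ℕ) : Set where
    field
      periodic  : Periodic f
      zero-rule : ∀ x → f x ≡ 0 → f (x + suc k) ≡ 1
      one-rule  : ∀ x → f x ≡ 1 → f (x + 2 * k) ≡ 0 ⊎ f (x + k) ≡ 0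
      step-rule : ∀ x m → f x ≡ suc (suc m) → f (x + 2 * k) ≡ suc m

  rules-from-period : ∀ {f} → Periodic f →
    (∀ x → x < n → f x ≡ 0 → f (x + suc k) ≡ 1) →
    (∀ x → x < n → f x ≡ 1 → f (x + 2 * k) ≡ 0 ⊎ f (x + k) ≡ 0) →
    (∀ x m → x < n → f x ≡ suc (suc m) → f (x + 2 * k) ≡ suc m) →
    CyclicSigma f
  rules-from-period {f} p zero-r one-r step-r = record
    { periodic  = p
    ; zero-rule = λ x e → lift x (zero-r (x % n) (m%n<n x n) (reduce x e))
    ; one-rule  = λ x e → Data.Sum.map (lift x) (lift x) (one-r (x % n) (m%n<n x n) (reduce x e))
    ; step-rule = λ x m e → lift x (step-r (x % n) m (m%n<n x n) (reduce x e))
    }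
    where
      reduce : ∀ x {v} → f x ≡ v → f (x % n) ≡ v
      reduce x e = trans (p x) e
      lift : ∀ x {m v} → f (x % n + m) ≡ v → f (x + m) ≡ v
      lift x {m} e = trans (sym (periodic-shift p x m)) e

  rotate-sigma : ∀ {f} → CyclicSigma f → ∀ d → CyclicSigma (λ x → f (x + d))
  rotate-sigma {f} σ d = record
    { periodic  = rotate-periodic periodic d
    ; zero-rule = λ x e → trans (commute x (suc k)) (zero-rule (x + d) e)
    ; one-rule  = λ x e → Data.Sum.map (trans (commute x (2 * k))) (trans (commute x k))
                                       (one-rule (x + d) e)
    ; step-rule = λ x m e → trans (commute x (2 * k)) (step-rule (x + d) m e)
    }
    where
      open CyclicSigma σ
      commute : ∀ x m → f (x + m + d) ≡ f (x + d + m)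
      commute x m =
        cong f (trans (+-assoc x m d) (trans (cong (x +_) (+-comm m d)) (sym (+-assoc x d m))))

  module Consequences {g : ℕ → ℕ} (σ : CyclicSigma g) where
    open CyclicSigma σ

    step-down : ∀ y w → g (suc y) ≡ suc (suc w) → g y ≡ suc w
    step-down y w e = trans (sym (back periodic y)) (step-rule (suc y) w e)

    run : ∀ t x v → g (t + x) ≡ t + suc v → g x ≡ suc v
    run zero    x v e = e
    run (suc t) x v e =
      run t x v (trans (step-down (t + x) (t + v) (trans e (cong suc (+-suc t v)))) (sym (+-suc t v)))

    ascend : ∀ y → g (suc y + k) ≢ 0 → g (suc y + suc k) ≢ 1 → g (suc y) ≡ suc (g y)
    ascend y k-ahead≢0 k+1-ahead≢1 with g (suc y) in e
    ... | zero = ⊥-elim (k+1-ahead≢1 (zero-rule (suc y) e))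
    ... | suc zero with one-rule (suc y) e
    ...   | inj₁ before≡0 = cong suc (sym (trans (sym (back periodic y)) before≡0))
    ...   | inj₂ ahead≡0  = ⊥-elim (k-ahead≢0 ahead≡0)
    ascend y _ _ | suc (suc m) = cong suc (sym (step-down y m e))

  data Region (x : ℕ) : Set where
    low  : x ≤ k → Region x
    high : ∀ i → i < k → x ≡ i + suc k → Region x

  region : ∀ x → x < n → Region x
  region x x<n with x ≤? k
  ... | yes x≤k = low x≤k
  ... | no x≰k with m≤n⇒∃[o]m+o≡n (≰⇒> x≰k)
  ...   | i , k+1+i≡x = high i i<k (trans (sym k+1+i≡x) (+-comm (suc k) i))
    where
      i<k : i < k
      i<k = subst (i <_) (+-identityʳ k)
              (+-cancelˡ-< k i (k + 0) (s<s⁻¹ (subst (_< n) (sym k+1+i≡x) x<n)))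

  word : ℕ → ℕ
  word r with r ≤? k
  ... | yes _ = r
  ... | no  _ = r ∸ k

  word-low : ∀ {r} → r ≤ k → word r ≡ r
  word-low {r} r≤k with r ≤? k
  ... | yes _   = refl
  ... | no  r≰k = ⊥-elim (r≰k r≤k)

  word-high : ∀ i → word (i + suc k) ≡ suc i
  word-high i with i + suc k ≤? k
  ... | yes le = ⊥-elim (<-irrefl refl (≤-trans (m≤n+m (suc k) i) le))
  ... | no  _  = trans (cong (_∸ k) (+-suc i k)) (m+n∸n≡m (suc i) k)

  word-zero : ∀ r → word r ≡ 0 → r ≡ 0
  word-zero r e with r ≤? k
  ... | yes _   = e
  ... | no  r≰k = ⊥-elim (r≰k (m∸n≡0⇒m≤n e))

  ω : ℕ → ℕ
  ω x = word (x % n)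

  ω-periodic : Periodic ω
  ω-periodic x = cong word (m%n%n≡m%n x n)

  ω-on-period : ∀ {x} → x < n → ω x ≡ word x
  ω-on-period x<n = cong word (m<n⇒m%n≡m x<n)

  ω-low : ∀ {x} → x ≤ k → ω x ≡ x
  ω-low x≤k = trans (ω-on-period (s≤s (≤-trans x≤k (m≤m+n k (k + 0))))) (word-low x≤k)

  ω-high : ∀ {i} → i < k → ω (i + suc k) ≡ suc i
  ω-high {i} i<k =
    trans (ω-on-period (s≤s (≤-trans (≤-reflexive (+-suc i k)) (+-mono-≤ i<k (m≤m+n k 0))))) (word-high i)

  ω-turn : ω n ≡ 0
  ω-turn = trans (wrap ω-periodic 0) (ω-low z≤n)

  ω-zero : ∀ {y} → y < n → ω y ≡ 0 → y ≡ 0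
  ω-zero {y} y<n e = word-zero y (trans (sym (ω-on-period y<n)) e)

  ω-sigma : CyclicSigma ω
  ω-sigma = rules-from-period ω-periodic zero-rule one-rule step-rule
    where
      zero-rule : ∀ x → x < n → ω x ≡ 0 → ω (x + suc k) ≡ 1
      zero-rule x x<n e with region x x<n
      ... | low x≤k = subst (λ y → ω (y + suc k) ≡ 1) (trans (sym e) (ω-low x≤k)) (ω-high (s≤s z≤n))
      ... | high i i<k refl = ⊥-elim (1+n≢0 (trans (sym (ω-high i<k)) e))

      one-rule : ∀ x → x < n → ω x ≡ 1 → ω (x + 2 * k) ≡ 0 ⊎ ω (x + k) ≡ 0
      one-rule x x<n e with region x x<n
      ... | low x≤k = inj₁ (subst (λ y → ω (y + 2 * k) ≡ 0) (trans (sym e) (ω-low x≤k)) ω-turn)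
      ... | high i i<k refl =
        inj₂ (trans (cong ω (full-turn k i)) (trans (wrap ω-periodic i) (trans (ω-low (<⇒≤ i<k)) i≡0)))
        where
          i≡0 : i ≡ 0
          i≡0 = suc-injective (trans (sym (ω-high i<k)) e)

      step-rule : ∀ x m → x < n → ω x ≡ suc (suc m) → ω (x + 2 * k) ≡ suc m
      step-rule x m x<n e with region x x<n
      ... | low x≤k = subst (λ y → ω (y + 2 * k) ≡ suc m) (sym x≡m+2)
                        (trans (back ω-periodic (suc m)) (ω-low (≤-trans (n≤1+n _) (subst (_≤ k) x≡m+2 x≤k))))
        where
          x≡m+2 : x ≡ suc (suc m)
          x≡m+2 = trans (sym (ω-low x≤k)) e
      ... | high i i<k refl with suc-injective (trans (sym (ω-high i<k)) e)
      ...   | refl = trans (back ω-periodic (m + suc k)) (ω-high (<⇒≤ i<k))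

  at : Vec ℕ n → ℕ → ℕ
  at a x = lookup a (fromℕ< (m%n<n x n))

  at-periodic : ∀ a → Periodic (at a)
  at-periodic a x = cong (lookup a) (fromℕ<-cong _ _ (m%n%n≡m%n x n) (m%n<n (x % n) n) (m%n<n x n))

  at-lookup : ∀ a i → at a (toℕ i) ≡ lookup a i
  at-lookup a i = cong (lookup a)
    (trans (fromℕ<-cong _ _ (m<n⇒m%n≡m (toℕ<n i)) (m%n<n (toℕ i) n) (toℕ<n i)) (fromℕ<-toℕ i (toℕ<n i)))

  head-at : ∀ a → head a ≡ at a 0
  head-at (x ∷ xs) = refl

  at-shift : ∀ a x m → lookup a (shift (fromℕ< (m%n<n x n)) m) ≡ at a (x + m)
  at-shift a x m =
    trans (cong (λ r → at a (r + m)) (toℕ-fromℕ< (m%n<n x n))) (periodic-shift (at-periodic a) x m)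

  sigma-at : ∀ a → IsSigma k a → CyclicSigma (at a)
  sigma-at a σ = record
    { periodic  = at-periodic a
    ; zero-rule = λ x e → trans (sym (at-shift a x (suc k))) (cond-ii _ e)
    ; one-rule  = λ x e → Data.Sum.map (trans (sym (at-shift a x (2 * k))))
                                       (trans (sym (at-shift a x k))) (cond-iii _ e)
    ; step-rule = λ x m e → trans (sym (at-shift a x (2 * k))) (cond-iv _ m e)
    }
    where open IsSigma σ

  table : (ℕ → ℕ) → Vec ℕ n
  table f = tabulate (λ i → f (toℕ i))

  table-shift : ∀ {f} → Periodic f → ∀ i m → lookup (table f) (shift i m) ≡ f (toℕ i + m)
  table-shift {f} p i m = trans (lookup∘tabulate (λ j → f (toℕ j)) (shift i m))
    (trans (cong f (toℕ-fromℕ< (m%n<n (toℕ i + m) n))) (p (toℕ i + m)))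

  table-sigma : ∀ {f} → CyclicSigma f → zeros (toList (table f)) ≤ 3 → IsSigma k (table f)
  table-sigma {f} σ few-zeros = record
    { cond-ii  = λ i e → trans (table-shift periodic i (suc k)) (zero-rule (toℕ i) (entry i e))
    ; cond-iii = λ i e → Data.Sum.map (trans (table-shift periodic i (2 * k)))
                                      (trans (table-shift periodic i k)) (one-rule (toℕ i) (entry i e))
    ; cond-iv  = λ i m e → trans (table-shift periodic i (2 * k)) (step-rule (toℕ i) m (entry i e))
    ; cond-v   = few-zeros
    }
    where
      open CyclicSigma σ
      entry : ∀ i {v} → lookup (table f) i ≡ v → f (toℕ i) ≡ v
      entry i e = trans (sym (lookup∘tabulate (λ j → f (toℕ j)) i)) e

  table-unique : ∀ a {f} → (∀ x → at a x ≡ f x) → a ≡ table f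
  table-unique a h =
    trans (sym (tabulate∘lookup a)) (tabulate-cong (λ i → trans (sym (at-lookup a i)) (h (toℕ i))))

  normal-form-A : ∀ {g} → CyclicSigma g → g 0 ≡ 0 → g k ≡ k → ∀ x → g x ≡ ω x
  normal-form-A {g} σ g0≡0 gk≡k = agree-everywhere periodic ω-periodic agree
    where
      open CyclicSigma σ
      open Consequences σ

      lower : ∀ x → x ≤ k → g x ≡ x
      lower zero    _   = g0≡0
      lower (suc m) m<k with m≤n⇒∃[o]m+o≡n m<k
      ... | t , m+1+t≡k = run t (suc m) m (trans (cong g pos) (trans gk≡k (sym pos)))
        where
          pos : t + suc m ≡ k
          pos = trans (+-comm t (suc m)) m+1+t≡k

      upper : ∀ i → i < k → g (i + suc k) ≡ suc i
      upper zero    _     = zero-rule 0 g0≡0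
      upper (suc i) i+1<k = trans (ascend (i + suc k) ahead≢0 ahead≢1) (cong suc (upper i (<⇒≤ i+1<k)))
        where
          -- the cells k and k+1 after i+k+2 are the low cells i+1 and i+2
          ahead≢0 : g (suc i + suc k + k) ≢ 0
          ahead≢0 e = 1+n≢0 (trans (sym (lower (suc i) (<⇒≤ i+1<k)))
                                    (trans (sym (wrap periodic (suc i))) (trans (sym (cong g (full-turn k (suc i)))) e)))
          ahead≢1 : g (suc i + suc k + suc k) ≢ 1
          ahead≢1 e with trans (sym (lower (suc (suc i)) i+1<k))
                         (trans (sym (wrap periodic (suc (suc i)))) (trans (sym (cong g (full-turn′ k (suc i)))) e))
          ... | ()

      agree : ∀ x → x < n → g x ≡ ω x
      agree x x<n with region x x<n
      ... | low x≤k          = trans (lower x x≤k) (sym (ω-low x≤k))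
      ... | high i i<k refl = trans (upper i i<k) (sym (ω-high i<k))

  normal-form-B : ∀ {g} → CyclicSigma g → g 0 ≡ 0 → g (2 * k) ≡ k → ∀ x → g x ≡ ω x
  normal-form-B {g} σ g0≡0 g2k≡k = agree-everywhere periodic ω-periodic agree
    where
      open CyclicSigma σ
      open Consequences σ

      upper : ∀ i → i < k → g (i + suc k) ≡ suc i
      upper i i<k with m≤n⇒∃[o]m+o≡n i<k
      ... | t , i+1+t≡k = run t (i + suc k) i (trans (cong g pos) (trans g2k≡k (sym val)))
        where
          pos : t + (i + suc k) ≡ 2 * k
          pos = subst (λ m → t + (i + suc m) ≡ 2 * m) i+1+t≡k (run-to-2k i t)
          val : t + suc i ≡ k
          val = trans (+-comm t (suc i)) i+1+t≡k

      lower : ∀ x → x ≤ k → g x ≡ x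
      lower zero    _   = g0≡0
      lower (suc y) y<k = trans (ascend y ahead≢0 ahead≢1) (cong suc (lower y (<⇒≤ y<k)))
        where
          -- the cell k after y+1 is the high cell y
          ahead≢0 : g (suc y + k) ≢ 0
          ahead≢0 e = 1+n≢0 (trans (sym (upper y y<k)) (trans (cong g (+-suc y k)) e))
          -- the cell k+1 after y+1 is the high cell y+1, or the cell n ≡ 0 when y+1 = k
          ahead≢1 : g (suc y + suc k) ≢ 1
          ahead≢1 e with m≤n⇒m<n∨m≡n y<k
          ... | inj₁ y+1<k with trans (sym (upper (suc y) y+1<k)) e
          ...   | ()
          ahead≢1 e | inj₂ refl with trans (sym g0≡0)
                                   (trans (sym (wrap periodic 0)) (trans (sym (cong g (half-turns k))) e))
          ...   | ()

      agree : ∀ x → x < n → g x ≡ ω x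
      agree x x<n with region x x<n
      ... | low x≤k          = trans (lower x x≤k) (sym (ω-low x≤k))
      ... | high i i<k refl = trans (upper i i<k) (sym (ω-high i<k))

  unrotate : ∀ {f} → Periodic f → ∀ d e → d + e ≡ n →
             (∀ x → f (x + d) ≡ ω x) → ∀ x → f x ≡ ω (x + e)
  unrotate {f} p d e d+e≡n h x = trans (sym (wrap p x)) (trans (cong f pos) (h (x + e)))
    where
      pos : x + n ≡ x + e + d
      pos = trans (cong (x +_) (trans (sym d+e≡n) (+-comm d e))) (sym (+-assoc x e d))

  rotated : ℕ → Vec ℕ n
  rotated e = table (λ x → ω (x + e))

  module Classification (a : Vec ℕ n) (σa : IsSigma k a) (a₀≡k : head a ≡ k) where
    σ : CyclicSigma (at a)
    σ = sigma-at a σa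
    open CyclicSigma σ
    open Consequences σ

    at-n≡k : at a n ≡ k
    at-n≡k = trans (wrap periodic 0) (trans (sym (head-at a)) a₀≡k)

    -- The entries before position n descend from k to the value 1 at position k+2.
    one-at-k+2 : at a (suc (suc k)) ≡ 1
    one-at-k+2 = run c (suc (suc k)) 0 (trans (cong (at a) (tail-length c)) (trans at-n≡k (sym (+-comm c 1))))

    -- Condition (iii) at position k+2 puts a zero at position k+1 or at position 1.
    zero-at-k+1-or-1 : at a (suc k) ≡ 0 ⊎ at a 1 ≡ 0
    zero-at-k+1-or-1 = Data.Sum.map (trans (sym (back periodic (suc k))))
                                    (trans (sym (trans (cong (at a) (full-turn k 1)) (wrap periodic 1))))
                                    (one-rule (suc (suc k)) one-at-k+2)

    -- Rotating the zero at k+1 to 0 gives normal form A.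
    zero-at-k+1 : at a (suc k) ≡ 0 → a ≡ rotated k
    zero-at-k+1 z = table-unique a (unrotate periodic (suc k) k (trans (+-comm (suc k) k) (half-turns k))
                      (normal-form-A (rotate-sigma σ (suc k)) z (trans (cong (at a) (half-turns k)) at-n≡k)))

    -- Rotating the zero at 1 to 0 gives normal form B.
    zero-at-1 : at a 1 ≡ 0 → a ≡ rotated (2 * k)
    zero-at-1 z = table-unique a (unrotate periodic 1 (2 * k) refl
                    (normal-form-B (rotate-sigma σ 1) z (trans (cong (at a) (+-comm (2 * k) 1)) at-n≡k)))

    classify : a ≡ rotated k ⊎ a ≡ rotated (2 * k)
    classify = Data.Sum.map zero-at-k+1 zero-at-1 zero-at-k+1-or-1

  -- A rotation of ω has a single zero per period.
  rotated-zero : ∀ {e j} → 0 < e → e ≤ n → j < n → ω (j + e) ≡ 0 → j + e ≡ n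
  rotated-zero {e} {j} 0<e e≤n j<n z with n ≤? j + e
  ... | no j+e<n = ⊥-elim (<⇒≢ 0<e (sym (m+n≡0⇒n≡0 j (ω-zero (≰⇒> j+e<n) z))))
  ... | yes n≤j+e with m≤n⇒∃[o]m+o≡n n≤j+e
  ...   | r , n+r≡j+e = trans (sym n+r≡j+e) (trans (cong (n +_) r≡0) (+-identityʳ n))
    where
      r<n : r < n
      r<n = +-cancelˡ-< n r n (subst (_< n + n) (sym n+r≡j+e) (+-mono-<-≤ j<n e≤n))
      r≡0 : r ≡ 0
      r≡0 = ω-zero r<n (trans (sym (wrap ω-periodic r)) (trans (cong ω (trans (+-comm r n) n+r≡j+e)) z))

  rotated-sigma : ∀ e → 0 < e → e ≤ n → IsSigma k (rotated e)
  rotated-sigma e 0<e e≤n =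
    table-sigma (rotate-sigma ω-sigma e) (≤-trans (at-most-one-zero n (λ x → ω (x + e)) one-zero) (s≤s z≤n))
    where
      one-zero : ∀ i j → i < n → j < n → ω (i + e) ≡ 0 → ω (j + e) ≡ 0 → i ≡ j
      one-zero i j i<n j<n zi zj =
        +-cancelʳ-≡ e i j (trans (rotated-zero 0<e e≤n i<n zi) (sym (rotated-zero 0<e e≤n j<n zj)))

  -- The two rotations start with k, and differ at position 1 (values 1 and 0).
  rotated-k-head : head (rotated k) ≡ k
  rotated-k-head = ω-low ≤-refl

  rotated-2k-head : head (rotated (2 * k)) ≡ k
  rotated-2k-head = trans (cong ω (double-as-high c)) (ω-high ≤-refl)

  rotations-differ : rotated k ≢ rotated (2 * k)
  rotations-differ e with trans (sym (ω-high (s≤s z≤n)))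
                               (trans (cong (λ v → lookup v (Fin.suc Fin.zero)) e) ω-turn)
  ... | ()

mainTheorem18 : (k : ℕ) → k ≥ 1 → SigmaCountIsTwo k
mainTheorem18 (suc c) _ =
    rotated k , rotated (2 * k)
  , (rotated-sigma k (s≤s z≤n) (m≤n⇒m≤1+n (m≤m+n k (k + 0))) , rotated-k-head)
  , (rotated-sigma (2 * k) (s≤s z≤n) (n≤1+n (2 * k)) , rotated-2k-head)
  , rotations-differ
  , λ a σa a₀≡k → Classification.classify a σa a₀≡k
  where open Cycle c
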